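{- Let $A$ be an irreducible $N\times N$ max-plus matrix and let $B_1$ and $\mu$ be as defined in the context. Then $\mu\le\lVert A\rVert\cdot B_1$.
   Context: Entries are in $\mathbb{R}\cup\{ -\infty\}$; max-plus product $(A\otimes B)_{i,j}=\max_k(A_{i,k}+B_{k,j})$, $A^{\otimes 0}$ is $0$ on the diagonal and $-\infty$ elsewhere. $G(A)$ is the directed graph on $\{1,\dots,N\}$ with edge $(i,j)$ of weight $A_{i,j}$ iff $A_{i,j}\neq-\infty$; irreducible means $G(A)$ strongly connected; $G(A)$ is assumed to have at least one edge. $\lVert A\rVert=\Delta-\delta$, where $\Delta,\delta$ are the maximum and minimum finite entries of $A$. A cycle is a closed walk with no nonempty closed proper subwalk. $\lambda(A)$ is the maximum average weight of a nonempty closed walk; critical closed walks attain it; critical edges lie on critical closed walks; $G_{\mathrm c}(A)$ is the subgraph formed by the critical edges and their endpoints. The cyclicity of a strongly connected graph is the gcd of its cycle lengths. The exploration penalty $ep(H)$ of a strongly connected graph $H$ is the least $e$ such that for each node $i$ of $H$ and each $n\ge e$ divisible by the cyclicity of $H$ there is a closed walk in $H$ of length $n$ at $i$. $\hat\gamma,\hat{ep}$ are the maximum cyclicity and maximum exploration penalty of the strongly connected components of $G_{\mathrm c}(A)$. $B_1=2(N-1)+\hat{ep}+ep(G(A))+\hat\gamma-1$, and $\mu=\sup\{A^{\otimes n}_{i,h}-A^{\otimes n}_{i,j}: h,i,j\in\{1,\dots,N\},\ n\ge B_1,\ A^{\otimes n}_{i,j}\ne-\infty\}$. -}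

module Defs where

open import Level using (0ℓ)
open import Data.Nat using (ℕ; zero; suc; _<_; _≤_; _∸_) renaming (_+_ to _+ℕ_; _*_ to _*ℕ_)
open import Data.Nat.Divisibility using (_∣_)
open import Data.Fin using (Fin)
open import Data.List using (List; foldr; allFin)
open import Data.Product using (Σ; ∃; _×_; _,_)
open import Data.Sum using (_⊎_; inj₁; inj₂)
open import Relation.Nullary using (¬_)
open import Relation.Binary.PropositionalEquality using (_≡_)
import Data.Unit
import Relation.Nullary
open import Algebra.Structures using (IsCommutativeRing)
open import Relation.Binary.Structures using (IsTotalOrder)

-- The real numbers, axiomatised as a complete ordered field.
-- (agda-stdlib has no reals; every model of this record is, classically,
-- isomorphic to ℝ, so quantifying over all models is a statement about ℝ.)

record RealNumbers : Set₁ where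
  infixl 6 _+_ _-_
  infixl 7 _*_
  infix 4 _≤ʳ_
  field
    ℝ    : Set
    _+_  : ℝ → ℝ → ℝ
    _*_  : ℝ → ℝ → ℝ
    -_   : ℝ → ℝ
    0r   : ℝ
    1r   : ℝ
    _≤ʳ_  : ℝ → ℝ → Set
    isCommutativeRing : IsCommutativeRing _≡_ _+_ _*_ -_ 0r 1r
    0≢1      : ¬ (0r ≡ 1r)
    inverse  : ∀ x → ¬ (x ≡ 0r) → Σ ℝ (λ y → x * y ≡ 1r)
    isTotalOrder : IsTotalOrder _≡_ _≤ʳ_
    +-monoˡ-≤ : ∀ {x y} z → x ≤ʳ y → x + z ≤ʳ y + z
    *-nonneg  : ∀ {x y} → 0r ≤ʳ x → 0r ≤ʳ y → 0r ≤ʳ x * y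
    complete : (P : ℝ → Set) → ∃ P → ∃ (λ b → ∀ x → P x → x ≤ʳ b) →
               ∃ (λ s → (∀ x → P x → x ≤ʳ s) × (∀ b → (∀ x → P x → x ≤ʳ b) → s ≤ʳ b))

  _-_ : ℝ → ℝ → ℝ
  x - y = x + (- y)

  total : ∀ x y → x ≤ʳ y ⊎ y ≤ʳ x
  total = IsTotalOrder.total isTotalOrder

  _·_ : ℕ → ℝ → ℝ
  zero  · x = 0r
  suc n · x = x + n · x

module MaxPlus (R : RealNumbers) where
  open RealNumbers R

  data ℝmax : Set where
    -∞  : ℝmax
    fin : ℝ → ℝmax

  _⊕_ : ℝmax → ℝmax → ℝmax
  -∞    ⊕ y     = y
  fin x ⊕ -∞    = fin x
  fin x ⊕ fin y with total x y
  ... | inj₁ _ = fin y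
  ... | inj₂ _ = fin x

  _⊗_ : ℝmax → ℝmax → ℝmax
  -∞    ⊗ y     = -∞
  fin x ⊗ -∞    = -∞
  fin x ⊗ fin y = fin (x + y)

  data _≤max_ : ℝmax → ℝmax → Set where
    -∞≤   : ∀ {y} → -∞ ≤max y
    fin≤  : ∀ {x y} → x ≤ʳ y → fin x ≤max fin y

  _⊙_ : ℕ → ℝmax → ℝmax
  zero  ⊙ x = fin 0r
  suc n ⊙ x = x ⊗ (n ⊙ x)

  Matrix : ℕ → Set
  Matrix N = Fin N → Fin N → ℝmax

  _⊗ᴹ_ : ∀ {N} → Matrix N → Matrix N → Matrix N
  _⊗ᴹ_ {N} A B i j = foldr (λ k acc → (A i k ⊗ B k j) ⊕ acc) -∞ (allFin N)

  Iᴹ : ∀ {N} → Matrix N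
  Iᴹ i j with Data.Fin._≟_ i j
  ... | Relation.Nullary.yes _ = fin 0r
  ... | Relation.Nullary.no  _ = -∞

  _^⊗_ : ∀ {N} → Matrix N → ℕ → Matrix N
  A ^⊗ zero  = Iᴹ
  A ^⊗ suc n = (A ^⊗ n) ⊗ᴹ A

record Graph (N : ℕ) : Set₁ where
  field
    Node : Fin N → Set
    Edge : Fin N → Fin N → Set

open Graph public

-- A walk of length len in the edge relation E, given by its node sequence
-- node 0, node 1, ..., node len (values of node beyond len are irrelevant).
record Walk {N : ℕ} (E : Fin N → Fin N → Set) : Set where
  field
    len  : ℕ
    node : ℕ → Fin N
    step : ∀ t → t < len → E (node t) (node (suc t))

open Walk public

Closed : ∀ {N} {E : Fin N → Fin N → Set} → Walk E → Set
Closed W = node W 0 ≡ node W (len W)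

NonemptyClosed : ∀ {N} {E : Fin N → Fin N → Set} → Walk E → Set
NonemptyClosed W = (0 < len W) × Closed W

-- a cycle: a nonempty closed walk with no nonempty closed proper subwalk
-- (the subwalk from position a to position b, 0 ≤ a < b ≤ len, is closed iff
-- node a ≡ node b, and proper iff (a , b) ≠ (0 , len))
IsCycle : ∀ {N} {E : Fin N → Fin N → Set} → Walk E → Set
IsCycle W = NonemptyClosed W ×
  (∀ a b → a < b → b ≤ len W → node W a ≡ node W b → (a ≡ 0) × (b ≡ len W))

WalkIn : ∀ {N} → Graph N → Set
WalkIn H = Walk (Edge H)

ClosedWalkAt : ∀ {N} (H : Graph N) → Fin N → ℕ → Set
ClosedWalkAt H i n =
  Σ (WalkIn H) λ W → (len W ≡ n) × (node W 0 ≡ i) × (node W n ≡ i)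

Reach : ∀ {N} → (Fin N → Fin N → Set) → Fin N → Fin N → Set
Reach E i j = Σ (Walk E) λ W → (node W 0 ≡ i) × (node W (len W) ≡ j)

StronglyConnected : ∀ {N} → Graph N → Set
StronglyConnected H = ∀ i j → Node H i → Node H j → Reach (Edge H) i j

IsCyclicity : ∀ {N} → Graph N → ℕ → Set
IsCyclicity H g =
  (∀ (C : WalkIn H) → IsCycle C → g ∣ len C) ×
  (∀ d → (∀ (C : WalkIn H) → IsCycle C → d ∣ len C) → d ∣ g)

ExploresFrom : ∀ {N} → Graph N → ℕ → ℕ → Set
ExploresFrom H g e =
  ∀ i → Node H i → ∀ n → e ≤ n → g ∣ n → ClosedWalkAt H i n

IsExplorationPenalty : ∀ {N} → Graph N → ℕ → Set
IsExplorationPenalty H e = Σ ℕ λ g → IsCyclicity H g ×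
  ExploresFrom H g e × (∀ e' → ExploresFrom H g e' → e ≤ e')

module MaxPlusGraphs (R : RealNumbers) where
  open RealNumbers R
  open MaxPlus R public

  module _ {N : ℕ} (A : Matrix N) where

    EdgeA : Fin N → Fin N → Set
    EdgeA i j = ¬ (A i j ≡ -∞)

    GA : Graph N
    GA = record { Node = λ _ → Data.Unit.⊤ ; Edge = EdgeA }

    Irreducible : Set
    Irreducible = StronglyConnected GA

    weightFrom : (ℕ → Fin N) → ℕ → ℝmax
    weightFrom p zero    = fin 0r
    weightFrom p (suc n) = A (p 0) (p 1) ⊗ weightFrom (λ t → p (suc t)) n

    weight : Walk EdgeA → ℝmax
    weight W = weightFrom (node W) (len W)

    -- a critical closed walk: a nonempty closed walk whose average weight
    -- w(W)/|W| is maximal, i.e. attains λ(A); written without division as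
    -- |W|·w(V) ≤ |V|·w(W) for every nonempty closed walk V
    Critical : Walk EdgeA → Set
    Critical W = NonemptyClosed W ×
      (∀ (V : Walk EdgeA) → NonemptyClosed V →
         (len W ⊙ weight V) ≤max (len V ⊙ weight W))

    CriticalEdge : Fin N → Fin N → Set
    CriticalEdge i j = Σ (Walk EdgeA) λ W → Critical W ×
      Σ ℕ λ t → (t < len W) × (node W t ≡ i) × (node W (suc t) ≡ j)

    CriticalNode : Fin N → Set
    CriticalNode i = Σ (Fin N) λ j → CriticalEdge i j ⊎ CriticalEdge j i

    Gc : Graph N
    Gc = record { Node = CriticalNode ; Edge = CriticalEdge }

    SCCc : Fin N → Graph N
    SCCc r = record
      { Node = InC
      ; Edge = λ i j → CriticalEdge i j × InC i × InC j }
      where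
      InC : Fin N → Set
      InC i = CriticalNode i × Reach CriticalEdge i r × Reach CriticalEdge r i

    IsMaxCyclicityGc : ℕ → Set
    IsMaxCyclicityGc γ =
      (Σ (Fin N) λ r → CriticalNode r × IsCyclicity (SCCc r) γ) ×
      (∀ r g → CriticalNode r → IsCyclicity (SCCc r) g → g ≤ γ)

    IsMaxEPGc : ℕ → Set
    IsMaxEPGc e =
      (Σ (Fin N) λ r → CriticalNode r × IsExplorationPenalty (SCCc r) e) ×
      (∀ r e' → CriticalNode r → IsExplorationPenalty (SCCc r) e' → e' ≤ e)

    IsMaxEntry : ℝ → Set
    IsMaxEntry Δ = (Σ (Fin N) λ i → Σ (Fin N) λ j → A i j ≡ fin Δ) ×
      (∀ i j x → A i j ≡ fin x → x ≤ʳ Δ)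

    IsMinEntry : ℝ → Set
    IsMinEntry δ = (Σ (Fin N) λ i → Σ (Fin N) λ j → A i j ≡ fin δ) ×
      (∀ i j x → A i j ≡ fin x → δ ≤ʳ x)

  B₁ : ℕ → ℕ → ℕ → ℕ → ℕ
  B₁ N ep̂ epG γ̂ = 2 *ℕ (N ∸ 1) +ℕ ep̂ +ℕ epG +ℕ γ̂ ∸ 1

-- Let m = ep(G(A)) + N - 1 and take an optimal walk of length n from i to h, of weight x.
-- From the node k it reaches after n - m steps, irreducibility gives a walk to j of length d < N.
-- All closed walks of G(A) split into cycles, so their lengths are divisible by the cyclicity g;
-- comparing with an optimal walk from i to j shows g ∣ m - d, and as m - d ≥ ep(G(A)) a closed walk
-- at j of length m - d exists.  The rerouted walk has length n and ends in j, so its weight is at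
-- most y, and it differs from the optimal one only in its last m edges: x - y ≤ m‖A‖ ≤ B₁‖A‖.

module Submission where

open import Defs
open import Data.Nat as ℕ using (ℕ; zero; suc; s≤s⁻¹; _∸_; _≤_; _<_; z≤n; s≤s; z<s; _≤?_; _<?_; _≟_)
open import Data.Nat.Properties
  using ( ≤-trans; ≤-reflexive; <⇒≤; <-≤-trans; ≤∧≢⇒<; ≮⇒≥; ≰⇒>; m+n≤o⇒n≤o; m+n≤o⇒m≤o∸n
        ; m∸n+n≡m; m+[n∸m]≡n; m∸n≤m; m∸[m∸n]≡n; ∸-monoˡ-≤; ∸-monoʳ-<; anyUpTo? )
open import Data.Nat.Divisibility using (_∣_; _∣0; ∣m∣n⇒∣m+n; ∣m+n∣m⇒∣n)
open import Data.Nat.Induction using (<-rec)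
open import Data.Nat.Tactic.RingSolver using (solve-∀)
open import Data.Fin as Fin using (Fin; toℕ)
open import Data.Fin.Properties using (pigeonhole; toℕ<n)
open import Data.List using (List; _∷_; foldr; allFin)
open import Data.List.Membership.Propositional using (_∈_)
open import Data.List.Membership.Propositional.Properties using (∈-allFin)
open import Data.List.Relation.Unary.Any using (here; there)
open import Data.Product using (Σ; ∃; ∃₂; _×_; _,_; proj₁; proj₂)
open import Data.Sum using (_⊎_; inj₁; inj₂)
open import Data.Empty using (⊥-elim)
open import Data.Unit using (tt)
open import Function using (_∘_)
open import Relation.Nullary using (¬_; Dec; yes; no)
open import Relation.Nullary.Decidable using (_×-dec_; ¬?; map′; decidable-stable)
open import Relation.Binary.PropositionalEquality
open import Algebra.Bundles using (AbelianGroup)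
open import Algebra.Structures using (IsCommutativeRing)
open import Relation.Binary.Bundles using (TotalOrder)
import Relation.Binary.Reasoning.PartialOrder

module NatProperties where
  open import Data.Nat using (_+_; _*_)
  open import Data.Nat.Properties using (+-assoc; +-monoˡ-<; m≤m+n)

  m∸n+[n+[o∸m]]≡o : ∀ {m n o} → n ≤ m → m ≤ o → (m ∸ n) + (n + (o ∸ m)) ≡ o
  m∸n+[n+[o∸m]]≡o {m} {n} {o} n≤m m≤o = begin
    (m ∸ n) + (n + (o ∸ m)) ≡⟨ +-assoc (m ∸ n) n (o ∸ m) ⟨
    (m ∸ n) + n + (o ∸ m)   ≡⟨ cong (_+ (o ∸ m)) (m∸n+n≡m n≤m) ⟩
    m + (o ∸ m)             ≡⟨ m+[n∸m]≡n m≤o ⟩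
    o                       ∎
    where open ≡-Reasoning

  n+[o∸m]<o : ∀ {m n o} → n < m → m ≤ o → n + (o ∸ m) < o
  n+[o∸m]<o {m} {n} {o} n<m m≤o = <-≤-trans (+-monoˡ-< (o ∸ m) n<m) (≤-reflexive (m+[n∸m]≡n m≤o))

  m∸n<o : ∀ {m n o} → n < m → m ≤ o → ¬ (n ≡ 0 × m ≡ o) → m ∸ n < o
  m∸n<o {n = zero}  _   m≤o notEnds = ≤∧≢⇒< m≤o (λ m≡o → notEnds (refl , m≡o))
  m∸n<o {n = suc n} n<m m≤o _       = <-≤-trans (∸-monoʳ-< z<s (<⇒≤ n<m)) m≤o

  [m+[n+o]]+p≡[m+[n+p]]+o : ∀ m n o p → (m + (n + o)) + p ≡ (m + (n + p)) + o
  [m+[n+o]]+p≡[m+[n+p]]+o = solve-∀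

  -- Once N ≥ 2 the right-hand side reduces definitionally to the one of the identity below.
  e+[N∸1]≤2[N∸1]+p+e+q∸1 : ∀ {N p e q} → 2 ≤ N → e + (N ∸ 1) ≤ 2 * (N ∸ 1) + p + e + q ∸ 1
  e+[N∸1]≤2[N∸1]+p+e+q∸1 {suc (suc k)} {p} {e} {q} (s≤s (s≤s z≤n)) =
    subst (e + suc k ≤_) (rearrange k p e q) (m≤m+n (e + suc k) (k + p + q))
    where
    rearrange : ∀ k p e q → e + suc k + (k + p + q) ≡ k + (suc k + 0) + p + e + q
    rearrange = solve-∀

Fin-≤1-irrelevant : ∀ {N} → N ≤ 1 → (h j : Fin N) → h ≡ j
Fin-≤1-irrelevant (s≤s z≤n) Fin.zero Fin.zero = refl

module RealProperties (R : RealNumbers) where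
  open RealNumbers R
  open IsCommutativeRing isCommutativeRing
    using (+-isAbelianGroup; +-comm; +-identityˡ; +-identityʳ; -‿inverseʳ)

  +-abelianGroup : AbelianGroup _ _
  +-abelianGroup = record { isAbelianGroup = +-isAbelianGroup }

  open import Algebra.Properties.AbelianGroup +-abelianGroup using (⁻¹-∙-comm; \\-leftDividesˡ)
  open import Algebra.Properties.CommutativeSemigroup (AbelianGroup.commutativeSemigroup +-abelianGroup)
    using (interchange; x∙yz≈y∙xz)

  ≤ʳ-totalOrder : TotalOrder _ _ _
  ≤ʳ-totalOrder = record { isTotalOrder = isTotalOrder }

  open TotalOrder ≤ʳ-totalOrder public
    using () renaming (refl to ≤ʳ-refl; reflexive to ≤ʳ-reflexive; trans to ≤ʳ-trans)
  open Relation.Binary.Reasoning.PartialOrder (TotalOrder.poset ≤ʳ-totalOrder)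

  +-monoʳ-≤ʳ : ∀ {x y} z → x ≤ʳ y → z + x ≤ʳ z + y
  +-monoʳ-≤ʳ {x} {y} z x≤y = subst₂ _≤ʳ_ (+-comm x z) (+-comm y z) (+-monoˡ-≤ z x≤y)

  +-mono-≤ʳ : ∀ {a b c d} → a ≤ʳ b → c ≤ʳ d → a + c ≤ʳ b + d
  +-mono-≤ʳ {b = b} {c} a≤b c≤d = ≤ʳ-trans (+-monoˡ-≤ c a≤b) (+-monoʳ-≤ʳ b c≤d)

  -‿antimono : ∀ {a b} → a ≤ʳ b → - b ≤ʳ - a
  -‿antimono {a} {b} a≤b = begin
    - b             ≡⟨ \\-leftDividesˡ a (- b) ⟨
    a + (- a + - b) ≤⟨ +-monoˡ-≤ (- a + - b) a≤b ⟩
    b + (- a + - b) ≡⟨ x∙yz≈y∙xz b (- a) (- b) ⟩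
    - a + (b - b)   ≡⟨ cong (- a +_) (-‿inverseʳ b) ⟩
    - a + 0r        ≡⟨ +-identityʳ (- a) ⟩
    - a             ∎

  -‿mono : ∀ {a b c d} → a ≤ʳ b → c ≤ʳ d → a - d ≤ʳ b - c
  -‿mono a≤b c≤d = +-mono-≤ʳ a≤b (-‿antimono c≤d)

  [a+b]-[c+d]≡[a-c]+[b-d] : ∀ a b c d → (a + b) - (c + d) ≡ (a - c) + (b - d)
  [a+b]-[c+d]≡[a-c]+[b-d] a b c d = trans (cong ((a + b) +_) (sym (⁻¹-∙-comm c d)))
                                          (interchange a b (- c) (- d))

  [a+b]-[a+c]≡b-c : ∀ a b c → (a + b) - (a + c) ≡ b - c
  [a+b]-[a+c]≡b-c a b c = trans ([a+b]-[c+d]≡[a-c]+[b-d] a b a c)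
                                (trans (cong (_+ (b - c)) (-‿inverseʳ a)) (+-identityˡ (b - c)))

  x≤y⇒0≤y-x : ∀ {x y} → x ≤ʳ y → 0r ≤ʳ y - x
  x≤y⇒0≤y-x {x} {y} x≤y = subst (_≤ʳ y - x) (-‿inverseʳ x) (+-monoˡ-≤ (- x) x≤y)

  ·-nonneg : ∀ n {z} → 0r ≤ʳ z → 0r ≤ʳ n · z
  ·-nonneg zero    _    = ≤ʳ-refl
  ·-nonneg (suc n) {z} 0≤z = subst (_≤ʳ z + n · z) (+-identityˡ 0r) (+-mono-≤ʳ 0≤z (·-nonneg n 0≤z))

  ·-monoˡ-≤ : ∀ {m n z} → m ≤ n → 0r ≤ʳ z → m · z ≤ʳ n · z
  ·-monoˡ-≤ {n = n} z≤n       0≤z = ·-nonneg n 0≤z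
  ·-monoˡ-≤ {z = z} (s≤s m≤n) 0≤z = +-monoʳ-≤ʳ z (·-monoˡ-≤ m≤n 0≤z)

module MaxPlusProperties (R : RealNumbers) where
  open RealNumbers R
  open MaxPlus R
  open RealProperties R

  fin≢-∞ : ∀ {x} → ¬ (fin x ≡ -∞)
  fin≢-∞ ()

  ≢-∞⇒fin : ∀ {a} → ¬ (a ≡ -∞) → ∃ λ x → a ≡ fin x
  ≢-∞⇒fin { -∞}    a≢-∞ = ⊥-elim (a≢-∞ refl)
  ≢-∞⇒fin {fin x} _    = x , refl

  fin-injective : ∀ {x y} → fin x ≡ fin y → x ≡ y
  fin-injective refl = refl

  fin≤fin⁻ : ∀ {x y} → fin x ≤max fin y → x ≤ʳ y
  fin≤fin⁻ (fin≤ x≤y) = x≤y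

  ≤max-trans : ∀ {a b c} → a ≤max b → b ≤max c → a ≤max c
  ≤max-trans -∞≤       _         = -∞≤
  ≤max-trans (fin≤ p) (fin≤ q) = fin≤ (≤ʳ-trans p q)

  ⊗-monoˡ-≤max : ∀ {a b} x → a ≤max b → (a ⊗ fin x) ≤max (b ⊗ fin x)
  ⊗-monoˡ-≤max x -∞≤       = -∞≤
  ⊗-monoˡ-≤max x (fin≤ p) = fin≤ (+-monoˡ-≤ x p)

  ⊕-upperˡ : ∀ a b → a ≤max (a ⊕ b)
  ⊕-upperˡ -∞      b       = -∞≤
  ⊕-upperˡ (fin x) -∞      = fin≤ ≤ʳ-refl
  ⊕-upperˡ (fin x) (fin y) with total x y
  ... | inj₁ x≤y = fin≤ x≤y
  ... | inj₂ _   = fin≤ ≤ʳ-refl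

  ⊕-upperʳ : ∀ a b → b ≤max (a ⊕ b)
  ⊕-upperʳ -∞      -∞      = -∞≤
  ⊕-upperʳ -∞      (fin y) = fin≤ ≤ʳ-refl
  ⊕-upperʳ (fin x) -∞      = -∞≤
  ⊕-upperʳ (fin x) (fin y) with total x y
  ... | inj₁ _   = fin≤ ≤ʳ-refl
  ... | inj₂ y≤x = fin≤ y≤x

  ⊕-selective : ∀ a b {x} → a ⊕ b ≡ fin x → a ≡ fin x ⊎ b ≡ fin x
  ⊕-selective -∞      b       eq = inj₂ eq
  ⊕-selective (fin y) -∞      eq = inj₁ eq
  ⊕-selective (fin y) (fin z) eq with total y z
  ... | inj₁ _ = inj₂ eq
  ... | inj₂ _ = inj₁ eq

  ⊗-fin⁻ : ∀ a b {x} → a ⊗ b ≡ fin x → ∃₂ λ u v → a ≡ fin u × b ≡ fin v × u + v ≡ x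
  ⊗-fin⁻ (fin u) (fin v) refl = u , v , refl , refl , refl

  module _ {N : ℕ} (f : Fin N → ℝmax) where

    ⨁ : List (Fin N) → ℝmax
    ⨁ = foldr (λ k acc → f k ⊕ acc) -∞

    ⨁-upper : ∀ {k} ks → k ∈ ks → f k ≤max ⨁ ks
    ⨁-upper (k ∷ ks) (here refl) = ⊕-upperˡ (f k) (⨁ ks)
    ⨁-upper (l ∷ ks) (there k∈ks) = ≤max-trans (⨁-upper ks k∈ks) (⊕-upperʳ (f l) (⨁ ks))

    ⨁-attained : ∀ ks {x} → ⨁ ks ≡ fin x → ∃ λ k → f k ≡ fin x
    ⨁-attained (k ∷ ks) eq with ⊕-selective (f k) (⨁ ks) eq
    ... | inj₁ fk≡x = k , fk≡x
    ... | inj₂ rest = ⨁-attained ks rest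

  module _ {N : ℕ} (A B : Matrix N) {i j : Fin N} where

    ⊗ᴹ-upper : ∀ k → (A i k ⊗ B k j) ≤max (A ⊗ᴹ B) i j
    ⊗ᴹ-upper k = ⨁-upper (λ l → A i l ⊗ B l j) (allFin N) (∈-allFin k)

    ⊗ᴹ-attained : ∀ {x} → (A ⊗ᴹ B) i j ≡ fin x → ∃ λ k → (A i k ⊗ B k j) ≡ fin x
    ⊗ᴹ-attained = ⨁-attained (λ l → A i l ⊗ B l j) (allFin N)

  Iᴹ-diagonal : ∀ {N} {i : Fin N} → Iᴹ i i ≡ fin 0r
  Iᴹ-diagonal {i = i} with i Fin.≟ i
  ... | yes _   = refl
  ... | no i≢i = ⊥-elim (i≢i refl)

  Iᴹ-fin⁻ : ∀ {N} {i j : Fin N} {x} → Iᴹ i j ≡ fin x → i ≡ j × 0r ≡ x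
  Iᴹ-fin⁻ {i = i} {j} eq with i Fin.≟ j
  Iᴹ-fin⁻ refl | yes i≡j = i≡j , refl

module Paths (R : RealNumbers) {N : ℕ} (A : MaxPlus.Matrix R N) where
  open import Data.Nat using (_+_)
  open import Data.Nat.Properties using (+-monoʳ-≤)
  open NatProperties
  open MaxPlusGraphs R
  open MaxPlusProperties R using (fin≢-∞; ≢-∞⇒fin)

  infixr 5 _∷_ _++_

  data Path : Fin N → Fin N → ℕ → Set where
    []  : ∀ {i} → Path i i 0
    _∷_ : ∀ {i k j n v} → A i k ≡ fin v → Path k j n → Path i j (suc n)

  _++_ : ∀ {i k j m n} → Path i k m → Path k j n → Path i j (m + n)
  []      ++ q = q
  (e ∷ p) ++ q = e ∷ (p ++ q)

  _∷ʳ_ : ∀ {i k j n v} → Path i k n → A k j ≡ fin v → Path i j (suc n)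
  []       ∷ʳ e = e ∷ []
  (e′ ∷ p) ∷ʳ e = e′ ∷ (p ∷ʳ e)

  data SnocView : ∀ {i j n} → Path i j (suc n) → Set where
    _∷ʳ′_ : ∀ {i k j n v} (p : Path i k n) (e : A k j ≡ fin v) → SnocView (p ∷ʳ e)

  snocView : ∀ {i j n} (p : Path i j (suc n)) → SnocView p
  snocView (e ∷ [])        = [] ∷ʳ′ e
  snocView (e ∷ p@(_ ∷ _)) = cons (snocView p)
    where
    cons : ∀ {p′} → SnocView p′ → SnocView (e ∷ p′)
    cons (q ∷ʳ′ e′) = (e ∷ q) ∷ʳ′ e′

  -- Positions beyond the end of a path are sent to its last node.
  nodeAt : ∀ {i j n} → Path i j n → ℕ → Fin N
  nodeAt {i} _       zero    = i
  nodeAt {i} []      (suc t) = i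
  nodeAt     (_ ∷ p) (suc t) = nodeAt p t

  nodeAt-end : ∀ {i j n} (p : Path i j n) → nodeAt p n ≡ j
  nodeAt-end []      = refl
  nodeAt-end (_ ∷ p) = nodeAt-end p

  take : ∀ {i j n} a → a ≤ n → (p : Path i j n) → Path i (nodeAt p a) a
  take zero    _         _       = []
  take (suc a) (s≤s a≤n) (e ∷ p) = e ∷ take a a≤n p

  drop : ∀ {i j n} a (p : Path i j n) → Path (nodeAt p a) j (n ∸ a)
  drop zero    p       = p
  drop (suc a) []      = []
  drop (suc a) (_ ∷ p) = drop a p

  nodeAt-drop : ∀ {i j n} a (p : Path i j n) t → nodeAt (drop a p) t ≡ nodeAt p (a + t)
  nodeAt-drop zero    p       t       = refl
  nodeAt-drop (suc a) []      zero    = refl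
  nodeAt-drop (suc a) []      (suc t) = refl
  nodeAt-drop (suc a) (_ ∷ p) t       = nodeAt-drop a p t

  excise : ∀ {i j n a b} → a ≤ b → b ≤ n → (p : Path i j n) → nodeAt p a ≡ nodeAt p b →
           Path (nodeAt p a) (nodeAt p a) (b ∸ a) × Path i j (a + (n ∸ b))
  excise {a = a} {b} a≤b b≤n p same =
    subst (λ k → Path _ k (b ∸ a)) loopEnd (take (b ∸ a) (∸-monoˡ-≤ a b≤n) (drop a p)) ,
    take a (≤-trans a≤b b≤n) p ++ subst (λ k → Path k _ _) (sym same) (drop b p)
    where
    loopEnd : nodeAt (drop a p) (b ∸ a) ≡ nodeAt p a
    loopEnd = trans (nodeAt-drop a p (b ∸ a)) (trans (cong (nodeAt p) (m+[n∸m]≡n a≤b)) (sym same))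

  edge : ∀ {i k v} → A i k ≡ fin v → EdgeA A i k
  edge e A≡-∞ = fin≢-∞ (trans (sym e) A≡-∞)

  nodeAt-step : ∀ {i j n} (p : Path i j n) t → t < n → EdgeA A (nodeAt p t) (nodeAt p (suc t))
  nodeAt-step (e ∷ p) zero    _         = edge e
  nodeAt-step (_ ∷ p) (suc t) (s≤s t<n) = nodeAt-step p t t<n

  toWalk : ∀ {i j n} → Path i j n → Walk (EdgeA A)
  toWalk {n = n} p = record { len = n ; node = nodeAt p ; step = nodeAt-step p }

  pathAlong : ∀ n (f : ℕ → Fin N) → (∀ t → t < n → EdgeA A (f t) (f (suc t))) → Path (f 0) (f n) n
  pathAlong zero    f _     = []
  pathAlong (suc n) f edges =
    proj₂ (≢-∞⇒fin (edges 0 z<s)) ∷ pathAlong n (f ∘ suc) (λ t t<n → edges (suc t) (s≤s t<n))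

  fromWalk : (W : Walk (EdgeA A)) → Path (node W 0) (node W (len W)) (len W)
  fromWalk W = pathAlong (len W) (node W) (step W)

  reachPath : ∀ {i j} → Reach (EdgeA A) i j → ∃ (Path i j)
  reachPath (W , refl , refl) = len W , fromWalk W

  closedWalkPath : ∀ {i n} → ClosedWalkAt (GA A) i n → Path i i n
  closedWalkPath (W , refl , refl , end) = subst (λ k → Path (node W 0) k (len W)) end (fromWalk W)

  IsProperRepeat : ∀ {i j n} → Path i j n → ℕ → ℕ → Set
  IsProperRepeat {n = n} p a b = a < b × b ≤ n × nodeAt p a ≡ nodeAt p b × ¬ (a ≡ 0 × b ≡ n)

  properRepeat? : ∀ {i j n} (p : Path i j n) → Dec (∃₂ (IsProperRepeat p))
  properRepeat? {n = n} p =
    map′ (λ (a , _ , b , _ , r) → a , b , r)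
         (λ (a , b , r@(a<b , b≤n , _)) → a , s≤s (≤-trans (<⇒≤ a<b) b≤n) , b , s≤s b≤n , r)
         (anyUpTo? (λ a → anyUpTo? (isProperRepeat? a) (suc n)) (suc n))
    where
    isProperRepeat? : ∀ a b → Dec (IsProperRepeat p a b)
    isProperRepeat? a b =
      a <? b ×-dec b ≤? n ×-dec nodeAt p a Fin.≟ nodeAt p b ×-dec ¬? (a ≟ 0 ×-dec b ≟ n)

  noProperRepeat⇒isCycle : ∀ {i n} (p : Path i i (suc n)) → ¬ ∃₂ (IsProperRepeat p) → IsCycle (toWalk p)
  noProperRepeat⇒isCycle {n = n} p noRepeat = (z<s , sym (nodeAt-end p)) , endsOnly
    where
    endsOnly : ∀ a b → a < b → b ≤ suc n → nodeAt p a ≡ nodeAt p b → (a ≡ 0) × (b ≡ suc n)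
    endsOnly a b a<b b≤n same = decidable-stable (a ≟ 0 ×-dec b ≟ suc n)
      (λ notEnds → noRepeat (a , b , a<b , b≤n , same , notEnds))

  CycleLengthsDivisibleBy : ℕ → Set
  CycleLengthsDivisibleBy g = ∀ (C : Walk (EdgeA A)) → IsCycle C → g ∣ len C

  module _ {g : ℕ} (cycles : CycleLengthsDivisibleBy g) where

    closed-length-divisible : ∀ {i n} → Path i i n → g ∣ n
    closed-length-divisible {n = n} = <-rec (λ n → ∀ {i} → Path i i n → g ∣ n) divisible n
      where
      divisible : ∀ n → (∀ {m} → m < n → ∀ {i} → Path i i m → g ∣ m) → ∀ {i} → Path i i n → g ∣ n
      divisible zero    _       _ = g ∣0
      divisible (suc n) shorter p with properRepeat? p
      ... | no noRepeat = cycles (toWalk p) (noProperRepeat⇒isCycle p noRepeat)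
      ... | yes (a , b , a<b , b≤n , same , notEnds) =
        subst (g ∣_) (m∸n+[n+[o∸m]]≡o (<⇒≤ a<b) b≤n)
          (∣m∣n⇒∣m+n (shorter (m∸n<o a<b b≤n notEnds) (proj₁ pieces))
                     (shorter (n+[o∸m]<o a<b b≤n) (proj₂ pieces)))
        where pieces = excise (<⇒≤ a<b) b≤n p same

  shortPath : ∀ {i j n} → Path i j n → ∃ λ d → d < N × Path i j d
  shortPath {n = n} = <-rec (λ n → ∀ {i j} → Path i j n → ∃ λ d → d < N × Path i j d) shorten n
    where
    shorten : ∀ n → (∀ {m} → m < n → ∀ {i j} → Path i j m → ∃ λ d → d < N × Path i j d) →
              ∀ {i j} → Path i j n → ∃ λ d → d < N × Path i j d
    shorten n shorter p with n <? N
    ... | yes n<N = n , n<N , p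
    ... | no n≮N with pigeonhole (s≤s (≮⇒≥ n≮N)) (nodeAt p ∘ toℕ)
    ... | a , b , a<b , same =
      shorter (n+[o∸m]<o a<b b≤n) (proj₂ (excise (<⇒≤ a<b) b≤n p same))
      where b≤n = s≤s⁻¹ (toℕ<n b)

  -- Any two walks from i to j have congruent lengths mod g, so the short detour from k to j
  -- can be padded by a closed walk at j to reach exactly the length ℓ.
  path-of-length : Irreducible A → ∀ {g e} → CycleLengthsDivisibleBy g → ExploresFrom (GA A) g e → ∀ {i k j a ℓ} → Path i k a → Path i j (a + ℓ) → e + (N ∸ 1) ≤ ℓ →
    Path k j ℓ
  path-of-length irreducible {g} {e} cycles explores {i} {k} {j} {a} {ℓ} P Q e+N∸1≤ℓ
    with d , d<N , D ← shortPath (proj₂ (reachPath (irreducible k j tt tt)))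
    with f , F ← reachPath (irreducible j i tt tt)
    = subst (Path k j) (m+[n∸m]≡n d≤ℓ) (D ++ C)
    where
    d≤N∸1 : d ≤ N ∸ 1
    d≤N∸1 = ∸-monoˡ-≤ 1 d<N
    d≤ℓ : d ≤ ℓ
    d≤ℓ = ≤-trans d≤N∸1 (m+n≤o⇒n≤o e e+N∸1≤ℓ)
    lengths : (a + (d + f)) + (ℓ ∸ d) ≡ (a + ℓ) + f
    lengths = trans ([m+[n+o]]+p≡[m+[n+p]]+o a d f (ℓ ∸ d)) (cong (λ t → a + t + f) (m+[n∸m]≡n d≤ℓ))
    g∣ℓ∸d : g ∣ ℓ ∸ d
    g∣ℓ∸d = ∣m+n∣m⇒∣n (subst (g ∣_) (sym lengths) (closed-length-divisible cycles (Q ++ F)))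
                       (closed-length-divisible cycles (P ++ D ++ F))
    C : Path j j (ℓ ∸ d)
    C = closedWalkPath (explores j tt (ℓ ∸ d)
          (m+n≤o⇒m≤o∸n e (≤-trans (+-monoʳ-≤ e d≤N∸1) e+N∸1≤ℓ)) g∣ℓ∸d)

module PathWeights (R : RealNumbers) {N : ℕ} (A : MaxPlus.Matrix R N) where
  open RealNumbers R
  open MaxPlusGraphs R
  open RealProperties R
  open MaxPlusProperties R
  open Paths R A
  open IsCommutativeRing isCommutativeRing using (+-assoc; +-identityˡ; +-identityʳ; -‿inverseʳ)
  open Relation.Binary.Reasoning.PartialOrder (TotalOrder.poset ≤ʳ-totalOrder)

  wt : ∀ {i j n} → Path i j n → ℝ
  wt []                = 0r
  wt (_∷_ {v = v} _ p) = v + wt p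

  wt-++ : ∀ {i k j m n} (p : Path i k m) (q : Path k j n) → wt (p ++ q) ≡ wt p + wt q
  wt-++ []                q = sym (+-identityˡ (wt q))
  wt-++ (_∷_ {v = v} _ p) q = trans (cong (v +_) (wt-++ p q)) (sym (+-assoc v (wt p) (wt q)))

  wt-∷ʳ : ∀ {i k j n v} (p : Path i k n) (e : A k j ≡ fin v) → wt (p ∷ʳ e) ≡ wt p + v
  wt-∷ʳ []                e = trans (+-identityʳ _) (sym (+-identityˡ _))
  wt-∷ʳ (_∷_ {v = u} _ p) e = trans (cong (u +_) (wt-∷ʳ p e)) (sym (+-assoc u (wt p) _))

  wt-take-drop : ∀ {i j n} a (a≤n : a ≤ n) (p : Path i j n) → wt p ≡ wt (take a a≤n p) + wt (drop a p)
  wt-take-drop zero    _         p                 = sym (+-identityˡ (wt p))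
  wt-take-drop (suc a) (s≤s a≤n) (_∷_ {v = v} _ p) =
    trans (cong (v +_) (wt-take-drop a a≤n p)) (sym (+-assoc v _ _))

  wt-≤max-power : ∀ n {i j} (p : Path i j n) → fin (wt p) ≤max (A ^⊗ n) i j
  wt-≤max-power zero    [] = subst (fin 0r ≤max_) (sym Iᴹ-diagonal) (fin≤ ≤ʳ-refl)
  wt-≤max-power (suc n) {i} {j} p with snocView p
  ... | _∷ʳ′_ {k = k} {v = v} q e = ≤max-trans last-step (⊗ᴹ-upper (A ^⊗ n) A k)
    where
    last-step : fin (wt (q ∷ʳ e)) ≤max ((A ^⊗ n) i k ⊗ A k j)
    last-step = subst₂ (λ w a → fin w ≤max ((A ^⊗ n) i k ⊗ a)) (sym (wt-∷ʳ q e)) (sym e)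
                       (⊗-monoˡ-≤max v (wt-≤max-power n q))

  wt≤power-entry : ∀ {n i j x} (p : Path i j n) → (A ^⊗ n) i j ≡ fin x → wt p ≤ʳ x
  wt≤power-entry {n} p eq = fin≤fin⁻ (subst (fin (wt p) ≤max_) eq (wt-≤max-power n p))

  power-path : ∀ n {i j x} → (A ^⊗ n) i j ≡ fin x → Σ (Path i j n) λ p → wt p ≡ x
  power-path zero eq with Iᴹ-fin⁻ eq
  ... | refl , refl = [] , refl
  power-path (suc n) eq with ⊗ᴹ-attained (A ^⊗ n) A eq
  ... | k , eqk with ⊗-fin⁻ ((A ^⊗ n) _ k) (A k _) eqk
  ... | u , v , eu , ev , u+v≡x with power-path n eu
  ... | q , wq≡u = q ∷ʳ ev , trans (wt-∷ʳ q ev) (trans (cong (_+ v) wq≡u) u+v≡x)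

  module _ {Δ δ : ℝ} (maxA : IsMaxEntry A Δ) (minA : IsMinEntry A δ) where

    δ≤Δ : δ ≤ʳ Δ
    δ≤Δ = let (i , j , Aij≡δ) = proj₁ minA in proj₂ maxA i j δ Aij≡δ

    wt-difference-≤ : ∀ {i j i′ j′ n} (p : Path i j n) (q : Path i′ j′ n) → wt p - wt q ≤ʳ n · (Δ - δ)
    wt-difference-≤ []                 []                 = ≤ʳ-reflexive (-‿inverseʳ 0r)
    wt-difference-≤ {n = suc n} (_∷_ {v = u} eu p) (_∷_ {v = v} ev q) = begin
      (u + wt p) - (v + wt q)  ≡⟨ [a+b]-[c+d]≡[a-c]+[b-d] u (wt p) v (wt q) ⟩
      (u - v) + (wt p - wt q)  ≤⟨ +-mono-≤ʳ (-‿mono (proj₂ maxA _ _ u eu) (proj₂ minA _ _ v ev))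
                                            (wt-difference-≤ p q) ⟩
      (Δ - δ) + n · (Δ - δ)    ∎

    power-difference-≤ : Irreducible A → ∀ {g e} → CycleLengthsDivisibleBy g → ExploresFrom (GA A) g e → ∀ {n x y} h i j → e ℕ.+ (N ∸ 1) ≤ n →
      (A ^⊗ n) i h ≡ fin x → (A ^⊗ n) i j ≡ fin y → x - y ≤ʳ (e ℕ.+ (N ∸ 1)) · (Δ - δ)
    power-difference-≤ irreducible {e = e} cycles explores {n} {x} {y} h i j threshold≤n Aⁿih≡x Aⁿij≡y
      with P , wtP≡x ← power-path n Aⁿih≡x
      with Q , _ ← power-path n Aⁿij≡y
      = begin
        x - y                               ≤⟨ -‿mono (≤ʳ-reflexive x≡P₁+P₂) P₁P₂′≤y ⟩
        (wt P₁ + wt P₂) - (wt P₁ + wt P₂′)  ≡⟨ [a+b]-[a+c]≡b-c (wt P₁) (wt P₂) (wt P₂′) ⟩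
        wt P₂ - wt P₂′                      ≤⟨ wt-difference-≤ P₂ P₂′ ⟩
        (n ∸ a) · (Δ - δ)                   ≡⟨ cong (_· (Δ - δ)) (m∸[m∸n]≡n threshold≤n) ⟩
        (e ℕ.+ (N ∸ 1)) · (Δ - δ)           ∎
      where
      a = n ∸ (e ℕ.+ (N ∸ 1))
      a≤n = m∸n≤m n (e ℕ.+ (N ∸ 1))
      a+[n∸a]≡n = m+[n∸m]≡n a≤n
      P₁ = take a a≤n P
      P₂ = drop a P
      P₂′ = path-of-length irreducible cycles explores P₁ (subst (Path i j) (sym a+[n∸a]≡n) Q)
            (≤-reflexive (sym (m∸[m∸n]≡n threshold≤n)))
      x≡P₁+P₂ : x ≡ wt P₁ + wt P₂
      x≡P₁+P₂ = trans (sym wtP≡x) (wt-take-drop a a≤n P)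
      P₁P₂′≤y : wt P₁ + wt P₂′ ≤ʳ y
      P₁P₂′≤y = subst (_≤ʳ y) (wt-++ P₁ P₂′)
        (wt≤power-entry (P₁ ++ P₂′) (subst (λ t → (A ^⊗ t) i j ≡ fin y) (sym a+[n∸a]≡n) Aⁿij≡y))

proposition7 : (R : RealNumbers) →
    let open RealNumbers R
        open MaxPlusGraphs R
    in
    (N : ℕ) (A : Matrix N) →
    Irreducible A →
    Σ (Fin N) (λ i → Σ (Fin N) (λ j → ¬ (A i j ≡ -∞))) →
    (γ̂ ep̂ epG : ℕ) →
    IsMaxCyclicityGc A γ̂ →
    IsMaxEPGc A ep̂ →
    IsExplorationPenalty (GA A) epG →
    (Δ δ : ℝ) → IsMaxEntry A Δ → IsMinEntry A δ →
    ∀ (h i j : Fin N) (n : ℕ) → B₁ N ep̂ epG γ̂ ≤ n →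
    ∀ (x y : ℝ) → (A ^⊗ n) i h ≡ fin x → (A ^⊗ n) i j ≡ fin y →
    x - y ≤ʳ B₁ N ep̂ epG γ̂ · (Δ - δ)
-- Only B₁ ≥ ep(G(A)) + N - 1 is used: the parameters of the critical graph merely enlarge B₁.
proposition7 R N A irreducible _ γ̂ ep̂ epG _ _ (_ , (cycles , _) , explores , _) Δ δ maxA minA
             h i j n B₁≤n x y Aⁿih≡x Aⁿij≡y =
  ≤ʳ-trans (proj₂ (proj₂ bound)) (·-monoˡ-≤ (proj₁ (proj₂ bound)) (x≤y⇒0≤y-x (δ≤Δ maxA minA)))
  where
  open RealNumbers R
  open MaxPlusGraphs R using (B₁; fin; _^⊗_)
  open RealProperties R
  open MaxPlusProperties R
  open PathWeights R A
  open IsCommutativeRing isCommutativeRing using (-‿inverseʳ)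
  open NatProperties using (e+[N∸1]≤2[N∸1]+p+e+q∸1)

  bound : ∃ λ m → m ≤ B₁ N ep̂ epG γ̂ × x - y ≤ʳ m · (Δ - δ)
  bound with N ≤? 1
  ... | yes N≤1 = 0 , z≤n , ≤ʳ-reflexive (trans (cong (λ z → x - z) (sym x≡y)) (-‿inverseʳ x))
    where
    x≡y : x ≡ y
    x≡y = fin-injective (trans (sym Aⁿij≡x) Aⁿij≡y)
      where Aⁿij≡x = subst (λ k → (A ^⊗ n) i k ≡ fin x) (Fin-≤1-irrelevant N≤1 h j) Aⁿih≡x
  ... | no N≰1 = _ , threshold ,
    power-difference-≤ maxA minA irreducible cycles explores h i j (≤-trans threshold B₁≤n) Aⁿih≡x Aⁿij≡y
    where threshold = e+[N∸1]≤2[N∸1]+p+e+q∸1 {N} {ep̂} {epG} {γ̂} (≰⇒> N≰1)
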